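{- Let $G$ be a finite simple graph and let $\Lambda\subseteq\Omega(G)$ with $|\Lambda|\ge 1$. Then $$d\Big(\bigcup\Lambda\Big)=\Big|\bigcap\Lambda\Big|+\Big|\bigcup\Lambda\Big|-|V(G)|\ \ge\ \max_{S\in\Lambda} d(S).$$ In particular, $$d(\mathrm{corona}(G))=|\mathrm{corona}(G)|+|\mathrm{core}(G)|-|V(G)|\ \ge\ 2\alpha(G)-|V(G)|=\max_{S\in\Omega(G)} d(S).$$
   Context: For $X\subseteq V(G)$, $N(X)$ is the set of vertices adjacent to some vertex of $X$, and $d(X)=|X|-|N(X)|$. $\alpha(G)$ is the maximum cardinality of an independent set (a set of pairwise non-adjacent vertices), $\Omega(G)$ is the family of all maximum independent sets, $\mathrm{core}(G)=\bigcap\Omega(G)$ and $\mathrm{corona}(G)=\bigcup\Omega(G)$. For a family $\Lambda$ of sets, $\bigcup\Lambda$ and $\bigcap\Lambda$ denote the union and intersection of its members. -}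

module Defs where

open import Data.Bool using (Bool; true; false)
open import Data.Bool.Properties using () renaming (_≟_ to _≟ᵇ_)
open import Data.Nat using (ℕ; _≤_; _≤?_)
open import Data.Integer using (ℤ; +_; _-_)
open import Data.Fin using (Fin)
open import Data.Fin.Properties using (any?; all?)
open import Data.Fin.Subset using (Subset; _∈_; _∉_; ∣_∣; _∪_; _∩_; ⊥; ⊤)
open import Data.Fin.Subset.Properties using (_∈?_; anySubset?)
open import Data.Vec using (tabulate)
open import Data.List using (foldr)
open import Data.List.NonEmpty using (List⁺; toList)
open import Data.Product using (Σ; ∃; _×_; _,_)
open import Relation.Binary.PropositionalEquality using (_≡_)
open import Relation.Nullary using (Dec; yes; no; ¬_; does)
open import Relation.Nullary.Decidable using (_×-dec_; _→-dec_; ¬?; decidable-stable)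

record Graph (n : ℕ) : Set where
  field
    adj    : Fin n → Fin n → Bool
    sym    : ∀ u v → adj u v ≡ adj v u
    irrefl : ∀ v → adj v v ≡ false
open Graph public

module _ {n : ℕ} (G : Graph n) where

  N : Subset n → Subset n
  N X = tabulate λ v → does (any? λ u → (u ∈? X) ×-dec (adj G u v ≟ᵇ true))

  d : Subset n → ℤ
  d X = + ∣ X ∣ - + ∣ N X ∣

  Independent : Subset n → Set
  Independent S = ∀ u v → u ∈ S → v ∈ S → adj G u v ≡ false

  independent? : (S : Subset n) → Dec (Independent S)
  independent? S = all? λ u → all? λ v → (u ∈? S) →-dec ((v ∈? S) →-dec (adj G u v ≟ᵇ false))

  MaximumIndependent : Subset n → Set
  MaximumIndependent S = Independent S × (∀ T → Independent T → ∣ T ∣ ≤ ∣ S ∣)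

private
  allSubset? : ∀ {n} {P : Subset n → Set} → (∀ S → Dec (P S)) → Dec (∀ S → P S)
  allSubset? {P = P} P? with anySubset? (λ S → ¬? (P? S))
  ... | yes (S , ¬p) = no λ f → ¬p (f S)
  ... | no ¬∃ = yes λ S → decidable-stable (P? S) (λ ¬p → ¬∃ (S , ¬p))

module _ {n : ℕ} (G : Graph n) where

  maximumIndependent? : (S : Subset n) → Dec (MaximumIndependent G S)
  maximumIndependent? S =
    independent? G S ×-dec allSubset? (λ T → independent? G T →-dec (∣ T ∣ ≤? ∣ S ∣))

  -- α(G): cardinality of a maximum independent set (0 only if none exists, which never happens)
  α : ℕ
  α with anySubset? maximumIndependent?
  ... | yes (S , _) = ∣ S ∣
  ... | no _ = 0

  core : Subset n
  core = tabulate λ v → does (allSubset? λ S → maximumIndependent? S →-dec (v ∈? S))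

  corona : Subset n
  corona = tabulate λ v → does (anySubset? λ S → maximumIndependent? S ×-dec (v ∈? S))

⋃ : ∀ {n} → List⁺ (Subset n) → Subset n
⋃ Λ = foldr _∪_ ⊥ (toList Λ)

⋂ : ∀ {n} → List⁺ (Subset n) → Subset n
⋂ Λ = foldr _∩_ ⊤ (toList Λ)

-- Let U and I be the union and the intersection of a family Λ of maximum independent sets.
-- A vertex outside I is missed by some S ∈ Λ and is therefore adjacent to S ⊆ U, while no
-- edge joins I to U; hence N(U) is exactly the complement of I, which gives the formula for
-- d(U). A maximum independent set S satisfies N(S) = V − S, so d(S) = 2α − |V|, and it
-- remains to show 2α ≤ |I| + |U|. Adding one more maximum independent set T to the family
-- does not decrease |I| + |U|: the exchange T ↦ (T − N(I)) ∪ I shows |I − T| ≤ |N(I) ∩ T|,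
-- and N(I) ∩ T ⊆ T − U since no edge joins I to U.
module Submission where

open import Defs renaming (sym to adj-sym)
open import Data.Bool using (true; false)
open import Data.Bool.Properties using () renaming (_≟_ to _≟ᵇ_)
open import Data.Fin using (Fin)
open import Data.Fin.Properties using (any?)
open import Data.Fin.Subset
  using (Subset; inside; outside; ∣_∣; _∪_; _∩_; _─_; ∁; ⁅_⁆; _⊆_; ⊥; ⊤)
  renaming (_∈_ to _∈ₛ_; _∉_ to _∉ₛ_)
open import Data.Fin.Subset.Properties
  using ( _∈?_; anySubset?; ⊆-antisym; p⊆q⇒∣p∣≤∣q∣; p⊂q⇒∣p∣<∣q∣; ∣p∣≤n; ∣∁p∣≡n∸∣p∣; ∉⊥; ∈⊤
        ; x∈⁅x⁆; x∈⁅y⁆⇒x≡y; x∉p⇒x∈∁p; x∈∁p⇒x∉p; p⊆p∪q; x∈p∪q⁺; x∈p∪q⁻; x∈p∩q⁺; x∈p∩q⁻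
        ; p─q⊆p; x∈p∧x∉q⇒x∈p─q; ∩-identityʳ; ∪-identityʳ)
open import Data.Integer using (+_; _+_; _-_; _*_; _≤_; -_; +≤+)
import Data.Integer.Properties as ℤ
open import Data.Integer.Tactic.RingSolver using (solve-∀)
open import Data.List using (List; []; _∷_; foldr; map; _++_; filter)
open import Data.List.Extrema.Nat using (argmax; argmax-all; f[xs]≤f[argmax])
open import Data.List.Membership.Propositional using (_∈_; find; lose)
open import Data.List.Membership.Propositional.Properties using (∈-map⁺; ∈-++⁺ˡ; ∈-++⁺ʳ; ∈-filter⁺)
open import Data.List.NonEmpty using (List⁺; _∷_; toList)
open import Data.List.Relation.Unary.All as All using (All; []; _∷_)
open import Data.List.Relation.Unary.All.Properties using (all-filter; ¬All⇒Any¬)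
open import Data.List.Relation.Unary.Any using (Any; here; there)
open import Data.Nat.Base as ℕ using (ℕ) hiding (module ℕ)
import Data.Nat.Properties as ℕ
open import Data.Product using (∃; _×_; _,_; proj₁; proj₂)
open import Data.Sum using (inj₁; inj₂)
open import Data.Vec using ([]; _∷_; tabulate; lookup; here; there)
open import Data.Vec.Properties using (lookup∘tabulate; []=⇒lookup; lookup⇒[]=)
open import Function using (_∘_)
open import Relation.Binary.PropositionalEquality
  using (_≡_; refl; sym; trans; cong; subst₂; module ≡-Reasoning)
open import Relation.Nullary using (Dec; yes; no; does; contradiction)
open import Relation.Nullary.Decidable using (dec-true; decidable-stable; ¬?; _×-dec_; _→-dec_)

∣p∣≡∣q∩p∣+∣p─q∣ : ∀ {n} (p q : Subset n) → ∣ p ∣ ≡ ∣ q ∩ p ∣ ℕ.+ ∣ p ─ q ∣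
∣p∣≡∣q∩p∣+∣p─q∣ []            []            = refl
∣p∣≡∣q∩p∣+∣p─q∣ (inside  ∷ p) (inside  ∷ q) = cong ℕ.suc (∣p∣≡∣q∩p∣+∣p─q∣ p q)
∣p∣≡∣q∩p∣+∣p─q∣ (inside  ∷ p) (outside ∷ q) =
  trans (cong ℕ.suc (∣p∣≡∣q∩p∣+∣p─q∣ p q)) (sym (ℕ.+-suc _ _))
∣p∣≡∣q∩p∣+∣p─q∣ (outside ∷ p) (inside  ∷ q) = ∣p∣≡∣q∩p∣+∣p─q∣ p q
∣p∣≡∣q∩p∣+∣p─q∣ (outside ∷ p) (outside ∷ q) = ∣p∣≡∣q∩p∣+∣p─q∣ p q

∣p∪q∣≡∣p─q∣+∣q∣ : ∀ {n} (p q : Subset n) → ∣ p ∪ q ∣ ≡ ∣ p ─ q ∣ ℕ.+ ∣ q ∣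
∣p∪q∣≡∣p─q∣+∣q∣ []            []            = refl
∣p∪q∣≡∣p─q∣+∣q∣ (inside  ∷ p) (inside  ∷ q) =
  trans (cong ℕ.suc (∣p∪q∣≡∣p─q∣+∣q∣ p q)) (sym (ℕ.+-suc _ _))
∣p∪q∣≡∣p─q∣+∣q∣ (inside  ∷ p) (outside ∷ q) = cong ℕ.suc (∣p∪q∣≡∣p─q∣+∣q∣ p q)
∣p∪q∣≡∣p─q∣+∣q∣ (outside ∷ p) (inside  ∷ q) =
  trans (cong ℕ.suc (∣p∪q∣≡∣p─q∣+∣q∣ p q)) (sym (ℕ.+-suc _ _))
∣p∪q∣≡∣p─q∣+∣q∣ (outside ∷ p) (outside ∷ q) = ∣p∪q∣≡∣p─q∣+∣q∣ p q

∣∁p∣+∣p∣≡n : ∀ {n} (p : Subset n) → ∣ ∁ p ∣ ℕ.+ ∣ p ∣ ≡ n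
∣∁p∣+∣p∣≡n p = trans (cong (ℕ._+ ∣ p ∣) (∣∁p∣≡n∸∣p∣ p)) (ℕ.m∸n+n≡m (∣p∣≤n p))

x∈p─q⇒x∉q : ∀ {n} {x : Fin n} (p q : Subset n) → x ∈ₛ p ─ q → x ∉ₛ q
x∈p─q⇒x∉q (inside ∷ p) (outside ∷ q) here      ()
x∈p─q⇒x∉q (_      ∷ p) (_       ∷ q) (there h) (there h′) = x∈p─q⇒x∉q p q h h′

module _ {n} {P : Fin n → Set} (P? : ∀ x → Dec (P x)) where

  ∈-tabulate⁺ : ∀ {x} → P x → x ∈ₛ tabulate (λ y → does (P? y))
  ∈-tabulate⁺ {x} px = lookup⇒[]= x _ (trans (lookup∘tabulate _ x) (dec-true (P? x) px))

  ∈-tabulate⁻ : ∀ {x} → x ∈ₛ tabulate (λ y → does (P? y)) → P x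
  ∈-tabulate⁻ {x} x∈ with P? x | trans (sym (lookup∘tabulate _ x)) ([]=⇒lookup x∈)
  ... | yes px | _  = px
  ... | no _   | ()

module _ {n} {x : Fin n} where

  ∈-⋃⁺ : ∀ {L} → Any (x ∈ₛ_) L → x ∈ₛ foldr _∪_ ⊥ L
  ∈-⋃⁺ (here x∈S)  = x∈p∪q⁺ (inj₁ x∈S)
  ∈-⋃⁺ (there x∈⋃) = x∈p∪q⁺ (inj₂ (∈-⋃⁺ x∈⋃))

  ∈-⋃⁻ : ∀ L → x ∈ₛ foldr _∪_ ⊥ L → Any (x ∈ₛ_) L
  ∈-⋃⁻ []      x∈⊥ = contradiction x∈⊥ ∉⊥
  ∈-⋃⁻ (S ∷ L) x∈  with x∈p∪q⁻ S _ x∈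
  ... | inj₁ x∈S = here x∈S
  ... | inj₂ x∈⋃ = there (∈-⋃⁻ L x∈⋃)

  ∈-⋂⁺ : ∀ {L} → All (x ∈ₛ_) L → x ∈ₛ foldr _∩_ ⊤ L
  ∈-⋂⁺ []            = ∈⊤
  ∈-⋂⁺ (x∈S ∷ x∈⋂) = x∈p∩q⁺ (x∈S , ∈-⋂⁺ x∈⋂)

  ∈-⋂⁻ : ∀ L → x ∈ₛ foldr _∩_ ⊤ L → All (x ∈ₛ_) L
  ∈-⋂⁻ []      _  = []
  ∈-⋂⁻ (S ∷ L) x∈ = proj₁ (x∈p∩q⁻ S _ x∈) ∷ ∈-⋂⁻ L (proj₂ (x∈p∩q⁻ S _ x∈))

subsets : ∀ n → List (Subset n)
subsets ℕ.zero    = [] ∷ []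
subsets (ℕ.suc n) = map (inside ∷_) (subsets n) ++ map (outside ∷_) (subsets n)

∈-subsets : ∀ {n} (p : Subset n) → p ∈ subsets n
∈-subsets []            = here refl
∈-subsets (inside  ∷ p) = ∈-++⁺ˡ (∈-map⁺ (inside ∷_) (∈-subsets p))
∈-subsets (outside ∷ p) = ∈-++⁺ʳ _ (∈-map⁺ (outside ∷_) (∈-subsets p))

+a-+b≡+i++a-+m : ∀ a {b i m} → b ℕ.+ i ≡ m → + a - + b ≡ + i + + a - + m
+a-+b≡+i++a-+m a {b} {i} refl =
  trans (shift (+ a) (+ b) (+ i)) (cong (λ k → + i + + a - k) (sym (ℤ.pos-+ b i)))
  where
  shift : ∀ x y z → x - y ≡ z + x - (y + z)
  shift = solve-∀

+2*x≡x+x : ∀ x → + 2 * x ≡ x + x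
+2*x≡x+x = solve-∀

module _ {n : ℕ} (G : Graph n) where

  adjacent-to? : ∀ X v → Dec (∃ λ u → u ∈ₛ X × adj G u v ≡ true)
  adjacent-to? X v = any? λ u → (u ∈? X) ×-dec (adj G u v ≟ᵇ true)

  ∈N⁺ : ∀ {X u v} → u ∈ₛ X → adj G u v ≡ true → v ∈ₛ N G X
  ∈N⁺ {X} u∈X uv = ∈-tabulate⁺ (adjacent-to? X) (_ , u∈X , uv)

  ∈N⁻ : ∀ {X v} → v ∈ₛ N G X → ∃ λ u → u ∈ₛ X × adj G u v ≡ true
  ∈N⁻ {X} = ∈-tabulate⁻ (adjacent-to? X)

  N-mono : ∀ {X Y} → X ⊆ Y → N G X ⊆ N G Y
  N-mono X⊆Y v∈NX with ∈N⁻ v∈NX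
  ... | u , u∈X , uv = ∈N⁺ (X⊆Y u∈X) uv

  ∈∧∉N⇒nonadjacent : ∀ {X u v} → u ∈ₛ X → v ∉ₛ N G X → adj G u v ≡ false
  ∈∧∉N⇒nonadjacent {u = u} {v} u∈X v∉NX with adj G u v in uv
  ... | true  = contradiction (∈N⁺ u∈X uv) v∉NX
  ... | false = refl

  independent-⊆ : ∀ {X Y} → X ⊆ Y → Independent G Y → Independent G X
  independent-⊆ X⊆Y iY u v u∈X v∈X = iY u v (X⊆Y u∈X) (X⊆Y v∈X)

  ⁅⁆-independent : ∀ v → Independent G ⁅ v ⁆
  ⁅⁆-independent v u w u∈ w∈ rewrite x∈⁅y⁆⇒x≡y v u∈ | x∈⁅y⁆⇒x≡y v w∈ = irrefl G v

  ∪-independent : ∀ {X Y} → Independent G X → Independent G Y →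
                  (∀ {u v} → u ∈ₛ X → v ∈ₛ Y → adj G u v ≡ false) → Independent G (X ∪ Y)
  ∪-independent {X} {Y} iX iY X≁Y u v u∈ v∈ with x∈p∪q⁻ X Y u∈ | x∈p∪q⁻ X Y v∈
  ... | inj₁ u∈X | inj₁ v∈X = iX u v u∈X v∈X
  ... | inj₁ u∈X | inj₂ v∈Y = X≁Y u∈X v∈Y
  ... | inj₂ u∈Y | inj₁ v∈X = trans (adj-sym G u v) (X≁Y v∈X u∈Y)
  ... | inj₂ u∈Y | inj₂ v∈Y = iY u v u∈Y v∈Y

  independent⇒∈N⇒∉ : ∀ {S v} → Independent G S → v ∈ₛ N G S → v ∉ₛ S
  independent⇒∈N⇒∉ iS v∈NS v∈S with ∈N⁻ v∈NS
  ... | u , u∈S , uv = contradiction (trans (sym uv) (iS _ _ u∈S v∈S)) λ ()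

  maximum⇒∉⇒∈N : ∀ {S v} → MaximumIndependent G S → v ∉ₛ S → v ∈ₛ N G S
  maximum⇒∉⇒∈N {S} {v} (iS , maxS) v∉S = decidable-stable (v ∈? N G S) λ v∉NS →
    ℕ.<⇒≱ ∣S∣<∣S∪v∣ (maxS (S ∪ ⁅ v ⁆) (∪-independent iS (⁅⁆-independent v) (S≁v v∉NS)))
    where
    ∣S∣<∣S∪v∣ : ∣ S ∣ ℕ.< ∣ S ∪ ⁅ v ⁆ ∣
    ∣S∣<∣S∪v∣ = p⊂q⇒∣p∣<∣q∣ (p⊆p∪q ⁅ v ⁆ , v , x∈p∪q⁺ (inj₂ (x∈⁅x⁆ v)) , v∉S)
    S≁v : v ∉ₛ N G S → ∀ {u w} → u ∈ₛ S → w ∈ₛ ⁅ v ⁆ → adj G u w ≡ false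
    S≁v v∉NS u∈S w∈⁅v⁆ rewrite x∈⁅y⁆⇒x≡y v w∈⁅v⁆ = ∈∧∉N⇒nonadjacent u∈S v∉NS

  N-maximum≡∁ : ∀ {S} → MaximumIndependent G S → N G S ≡ ∁ S
  N-maximum≡∁ mS = ⊆-antisym (x∉p⇒x∈∁p ∘ independent⇒∈N⇒∉ (proj₁ mS)) (maximum⇒∉⇒∈N mS ∘ x∈∁p⇒x∉p)

  d-N≡∁ : ∀ {X I} → N G X ≡ ∁ I → d G X ≡ + ∣ I ∣ + + ∣ X ∣ - + n
  d-N≡∁ {X} {I} NX≡∁I =
    +a-+b≡+i++a-+m ∣ X ∣ (trans (cong (λ Y → ∣ Y ∣ ℕ.+ ∣ I ∣) NX≡∁I) (∣∁p∣+∣p∣≡n I))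

  α≡∣S∣ : ∀ {S} → MaximumIndependent G S → α G ≡ ∣ S ∣
  α≡∣S∣ {S} (iS , maxS) with anySubset? (maximumIndependent? G)
  ... | yes (S′ , iS′ , maxS′) = ℕ.≤-antisym (maxS S′ iS′) (maxS′ S iS)
  ... | no ∄S = contradiction (S , iS , maxS) ∄S

  d-maximum : ∀ {S} → MaximumIndependent G S → d G S ≡ + 2 * + α G - + n
  d-maximum {S} mS = begin
    d G S                       ≡⟨ d-N≡∁ (N-maximum≡∁ mS) ⟩
    + ∣ S ∣ + + ∣ S ∣ - + n     ≡⟨ cong (_- + n) (sym (+2*x≡x+x (+ ∣ S ∣))) ⟩
    + 2 * + ∣ S ∣ - + n         ≡⟨ cong (λ a → + 2 * + a - + n) (sym (α≡∣S∣ mS)) ⟩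
    + 2 * + α G - + n           ∎
    where open ≡-Reasoning

  -- Y ∪ (T − N(Y)) is independent, hence no larger than T.
  ∣Y─T∣≤∣NY∩T∣ : ∀ {Y T} → Independent G Y → MaximumIndependent G T →
                 ∣ Y ─ T ∣ ℕ.≤ ∣ N G Y ∩ T ∣
  ∣Y─T∣≤∣NY∩T∣ {Y} {T} iY (iT , maxT) = ℕ.+-cancelʳ-≤ ∣ T ─ N G Y ∣ _ _ (begin
    ∣ Y ─ T ∣ ℕ.+ ∣ T ─ N G Y ∣             ≤⟨ ℕ.+-monoˡ-≤ _ (p⊆q⇒∣p∣≤∣q∣ Y─T⊆Y─T′) ⟩
    ∣ Y ─ (T ─ N G Y) ∣ ℕ.+ ∣ T ─ N G Y ∣   ≡⟨ sym (∣p∪q∣≡∣p─q∣+∣q∣ Y (T ─ N G Y)) ⟩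
    ∣ Y ∪ (T ─ N G Y) ∣                      ≤⟨ maxT _ (∪-independent iY iT′ Y≁T′) ⟩
    ∣ T ∣                                    ≡⟨ ∣p∣≡∣q∩p∣+∣p─q∣ T (N G Y) ⟩
    ∣ N G Y ∩ T ∣ ℕ.+ ∣ T ─ N G Y ∣         ∎)
    where
    open ℕ.≤-Reasoning
    iT′ : Independent G (T ─ N G Y)
    iT′ = independent-⊆ (p─q⊆p T (N G Y)) iT
    Y≁T′ : ∀ {u v} → u ∈ₛ Y → v ∈ₛ T ─ N G Y → adj G u v ≡ false
    Y≁T′ u∈Y v∈T′ = ∈∧∉N⇒nonadjacent u∈Y (x∈p─q⇒x∉q T (N G Y) v∈T′)
    Y─T⊆Y─T′ : Y ─ T ⊆ Y ─ (T ─ N G Y)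
    Y─T⊆Y─T′ v∈ = x∈p∧x∉q⇒x∈p─q (p─q⊆p Y T v∈) (x∈p─q⇒x∉q Y T v∈ ∘ p─q⊆p T (N G Y))

  ∣I∣+∣U∣≤∣T∩I∣+∣T∪U∣ : ∀ {I U T} → Independent G I → (∀ {v} → v ∈ₛ N G I → v ∉ₛ U) →
                        MaximumIndependent G T → ∣ I ∣ ℕ.+ ∣ U ∣ ℕ.≤ ∣ T ∩ I ∣ ℕ.+ ∣ T ∪ U ∣
  ∣I∣+∣U∣≤∣T∩I∣+∣T∪U∣ {I} {U} {T} iI NI∩U≡∅ mT = begin
    ∣ I ∣ ℕ.+ ∣ U ∣                          ≡⟨ cong (ℕ._+ ∣ U ∣) (∣p∣≡∣q∩p∣+∣p─q∣ I T) ⟩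
    (∣ T ∩ I ∣ ℕ.+ ∣ I ─ T ∣) ℕ.+ ∣ U ∣     ≡⟨ ℕ.+-assoc ∣ T ∩ I ∣ _ _ ⟩
    ∣ T ∩ I ∣ ℕ.+ (∣ I ─ T ∣ ℕ.+ ∣ U ∣)     ≤⟨ ℕ.+-monoʳ-≤ ∣ T ∩ I ∣ (ℕ.+-monoˡ-≤ ∣ U ∣ ∣I─T∣≤∣T─U∣) ⟩
    ∣ T ∩ I ∣ ℕ.+ (∣ T ─ U ∣ ℕ.+ ∣ U ∣)     ≡⟨ cong (∣ T ∩ I ∣ ℕ.+_) (sym (∣p∪q∣≡∣p─q∣+∣q∣ T U)) ⟩
    ∣ T ∩ I ∣ ℕ.+ ∣ T ∪ U ∣                  ∎
    where
    open ℕ.≤-Reasoning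
    NI∩T⊆T─U : N G I ∩ T ⊆ T ─ U
    NI∩T⊆T─U v∈ = x∈p∧x∉q⇒x∈p─q (proj₂ (x∈p∩q⁻ _ T v∈)) (NI∩U≡∅ (proj₁ (x∈p∩q⁻ _ T v∈)))
    ∣I─T∣≤∣T─U∣ : ∣ I ─ T ∣ ℕ.≤ ∣ T ─ U ∣
    ∣I─T∣≤∣T─U∣ = ℕ.≤-trans (∣Y─T∣≤∣NY∩T∣ iI mT) (p⊆q⇒∣p∣≤∣q∣ NI∩T⊆T─U)

  module _ {L : List (Subset n)} (maxL : All (MaximumIndependent G) L) where

    ⋂-⋃-nonadjacent : ∀ {u v} → u ∈ₛ foldr _∩_ ⊤ L → v ∈ₛ foldr _∪_ ⊥ L → adj G u v ≡ false
    ⋂-⋃-nonadjacent u∈⋂ v∈⋃ with find (∈-⋃⁻ L v∈⋃)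
    ... | S , S∈L , v∈S = proj₁ (All.lookup maxL S∈L) _ _ (All.lookup (∈-⋂⁻ L u∈⋂) S∈L) v∈S

    ∈N⋂⇒∉⋃ : ∀ {v} → v ∈ₛ N G (foldr _∩_ ⊤ L) → v ∉ₛ foldr _∪_ ⊥ L
    ∈N⋂⇒∉⋃ v∈N⋂ v∈⋃ with ∈N⁻ v∈N⋂
    ... | u , u∈⋂ , uv = contradiction (trans (sym uv) (⋂-⋃-nonadjacent u∈⋂ v∈⋃)) λ ()

    ∉⋂⇒∈N⋃ : ∀ {v} → v ∉ₛ foldr _∩_ ⊤ L → v ∈ₛ N G (foldr _∪_ ⊥ L)
    ∉⋂⇒∈N⋃ {v} v∉⋂ with find (¬All⇒Any¬ (v ∈?_) L (v∉⋂ ∘ ∈-⋂⁺))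
    ... | S , S∈L , v∉S = N-mono (∈-⋃⁺ ∘ lose S∈L) (maximum⇒∉⇒∈N (All.lookup maxL S∈L) v∉S)

    ∈N⋃⇒∉⋂ : ∀ {v} → v ∈ₛ N G (foldr _∪_ ⊥ L) → v ∉ₛ foldr _∩_ ⊤ L
    ∈N⋃⇒∉⋂ v∈N⋃ v∈⋂ with ∈N⁻ v∈N⋃
    ... | u , u∈⋃ , uv =
      contradiction (trans (sym uv) (trans (adj-sym G _ _) (⋂-⋃-nonadjacent v∈⋂ u∈⋃))) λ ()

    N⋃≡∁⋂ : N G (foldr _∪_ ⊥ L) ≡ ∁ (foldr _∩_ ⊤ L)
    N⋃≡∁⋂ = ⊆-antisym (x∉p⇒x∈∁p ∘ ∈N⋃⇒∉⋂) (∉⋂⇒∈N⋃ ∘ x∈∁p⇒x∉p)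

  α+α≤∣⋂∣+∣⋃∣ : ∀ Λ → All (MaximumIndependent G) (toList Λ) → α G ℕ.+ α G ℕ.≤ ∣ ⋂ Λ ∣ ℕ.+ ∣ ⋃ Λ ∣
  α+α≤∣⋂∣+∣⋃∣ (S ∷ []) (mS ∷ []) rewrite ∩-identityʳ S | ∪-identityʳ S | α≡∣S∣ mS = ℕ.≤-refl
  α+α≤∣⋂∣+∣⋃∣ (T ∷ S ∷ L) (mT ∷ maxSL) =
    ℕ.≤-trans (α+α≤∣⋂∣+∣⋃∣ (S ∷ L) maxSL)
              (∣I∣+∣U∣≤∣T∩I∣+∣T∪U∣ iI (∈N⋂⇒∉⋃ maxSL) mT)
    where
    iI : Independent G (foldr _∩_ ⊤ (S ∷ L))
    iI = independent-⊆ (All.head ∘ ∈-⋂⁻ (S ∷ L)) (proj₁ (All.head maxSL))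

  module _ (Λ : List⁺ (Subset n)) (maxΛ : All (MaximumIndependent G) (toList Λ)) where

    d-⋃ : d G (⋃ Λ) ≡ + ∣ ⋂ Λ ∣ + + ∣ ⋃ Λ ∣ - + n
    d-⋃ = d-N≡∁ (N⋃≡∁⋂ maxΛ)

    d≤d-⋃ : ∀ {S} → S ∈ toList Λ → d G S ≤ d G (⋃ Λ)
    d≤d-⋃ {S} S∈Λ = begin
      d G S                              ≡⟨ d-maximum (All.lookup maxΛ S∈Λ) ⟩
      + 2 * + α G - + n                  ≡⟨ cong (_- + n) (+2*x≡x+x (+ α G)) ⟩
      + α G + + α G - + n                ≤⟨ ℤ.+-monoˡ-≤ (- + n) α+α≤ ⟩
      + ∣ ⋂ Λ ∣ + + ∣ ⋃ Λ ∣ - + n        ≡⟨ sym d-⋃ ⟩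
      d G (⋃ Λ)                          ∎
      where
      open ℤ.≤-Reasoning
      α+α≤ : + α G + + α G ≤ + ∣ ⋂ Λ ∣ + + ∣ ⋃ Λ ∣
      α+α≤ = subst₂ _≤_ (ℤ.pos-+ (α G) (α G)) (ℤ.pos-+ ∣ ⋂ Λ ∣ ∣ ⋃ Λ ∣) (+≤+ (α+α≤∣⋂∣+∣⋃∣ Λ maxΛ))

  maximumIndependent-exists : ∃ (MaximumIndependent G)
  maximumIndependent-exists =
    S₀ , argmax-all ∣_∣ ⊥-independent (all-filter (independent? G) (subsets n))
       , λ T iT → All.lookup (f[xs]≤f[argmax] {f = ∣_∣} ⊥ independents)
                             (∈-filter⁺ (independent? G) (∈-subsets T) iT)
    where
    independents = filter (independent? G) (subsets n)
    S₀ = argmax ∣_∣ ⊥ independents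
    ⊥-independent : Independent G ⊥
    ⊥-independent u _ u∈⊥ _ = contradiction u∈⊥ ∉⊥

  Ω : List⁺ (Subset n)
  Ω = proj₁ maximumIndependent-exists ∷ filter (maximumIndependent? G) (subsets n)

  Ω-maximum : All (MaximumIndependent G) (toList Ω)
  Ω-maximum = proj₂ maximumIndependent-exists ∷ all-filter (maximumIndependent? G) (subsets n)

  ∈-Ω : ∀ {S} → MaximumIndependent G S → S ∈ toList Ω
  ∈-Ω {S} mS = there (∈-filter⁺ (maximumIndependent? G) (∈-subsets S) mS)

  in-maximum? : ∀ v → Dec (∃ λ S → MaximumIndependent G S × v ∈ₛ S)
  in-maximum? v = anySubset? λ S → maximumIndependent? G S ×-dec (v ∈? S)

  ∈corona⁺ : ∀ {S v} → MaximumIndependent G S → v ∈ₛ S → v ∈ₛ corona G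
  ∈corona⁺ mS v∈S = ∈-tabulate⁺ in-maximum? (_ , mS , v∈S)

  ∈corona⁻ : ∀ {v} → v ∈ₛ corona G → ∃ λ S → MaximumIndependent G S × v ∈ₛ S
  ∈corona⁻ = ∈-tabulate⁻ in-maximum?

  -- core is computed by the private allSubset? of Defs, which is a with on anySubset?; matching
  -- on that same call unfolds it. The refl forces the function inside core to be inferred.
  ∈core⁺ : ∀ {v} → (∀ S → MaximumIndependent G S → v ∈ₛ S) → v ∈ₛ core G
  ∈core⁺ {v} v∈Ω with trans (refl {x = lookup (core G) v}) (lookup∘tabulate _ v)
  ... | core[v] with anySubset? (λ S → ¬? (maximumIndependent? G S →-dec (v ∈? S)))
  ...   | yes (S , v∉S) = contradiction (v∈Ω S) v∉S
  ...   | no _          = lookup⇒[]= v (core G) core[v]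

  ∈core⁻ : ∀ {v} → v ∈ₛ core G → ∀ S → MaximumIndependent G S → v ∈ₛ S
  ∈core⁻ {v} v∈ S mS with trans (sym (lookup∘tabulate _ v)) ([]=⇒lookup v∈)
  ... | core[v] with anySubset? (λ S → ¬? (maximumIndependent? G S →-dec (v ∈? S)))
  ...   | yes _ = contradiction core[v] λ ()
  ...   | no ∄S = decidable-stable (v ∈? S) λ v∉S → ∄S (S , λ v∈Ω → v∉S (v∈Ω mS))

  corona≡⋃Ω : corona G ≡ ⋃ Ω
  corona≡⋃Ω = ⊆-antisym into onto
    where
    into : corona G ⊆ ⋃ Ω
    into v∈ with ∈corona⁻ v∈
    ... | S , mS , v∈S = ∈-⋃⁺ (lose (∈-Ω mS) v∈S)
    onto : ⋃ Ω ⊆ corona G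
    onto v∈ with find (∈-⋃⁻ (toList Ω) v∈)
    ... | S , S∈Ω , v∈S = ∈corona⁺ (All.lookup Ω-maximum S∈Ω) v∈S

  core≡⋂Ω : core G ≡ ⋂ Ω
  core≡⋂Ω = ⊆-antisym
    (λ v∈ → ∈-⋂⁺ (All.tabulate λ S∈Ω → ∈core⁻ v∈ _ (All.lookup Ω-maximum S∈Ω)))
    (λ v∈ → ∈core⁺ λ S mS → All.lookup (∈-⋂⁻ (toList Ω) v∈) (∈-Ω mS))

theorem3p1 : ∀ {n : ℕ} (G : Graph n) →
    ((Λ : List⁺ (Subset n)) → All (MaximumIndependent G) (toList Λ) →
      (d G (⋃ Λ) ≡ + ∣ ⋂ Λ ∣ + + ∣ ⋃ Λ ∣ - + n)
      × (∀ S → S ∈ toList Λ → d G S ≤ d G (⋃ Λ)))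
    × ((d G (corona G) ≡ + ∣ corona G ∣ + + ∣ core G ∣ - + n)
      × ((+ 2 * + α G - + n) ≤ d G (corona G))
      × (∃ λ S → MaximumIndependent G S × d G S ≡ + 2 * + α G - + n)
      × (∀ S → MaximumIndependent G S → d G S ≤ + 2 * + α G - + n))
theorem3p1 {n} G rewrite corona≡⋃Ω G | core≡⋂Ω G =
    (λ Λ maxΛ → d-⋃ G Λ maxΛ , λ _ → d≤d-⋃ G Λ maxΛ)
  , trans (d-⋃ G (Ω G) (Ω-maximum G)) (cong (_- + n) (ℤ.+-comm (+ ∣ ⋂ (Ω G) ∣) (+ ∣ ⋃ (Ω G) ∣)))
  , ℤ.≤-trans (ℤ.≤-reflexive (sym (d-maximum G m₀))) (d≤d-⋃ G (Ω G) (Ω-maximum G) (here refl))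
  , (S₀ , m₀ , d-maximum G m₀)
  , (λ _ mS → ℤ.≤-reflexive (d-maximum G mS))
  where
  S₀ = proj₁ (maximumIndependent-exists G)
  m₀ = proj₂ (maximumIndependent-exists G)
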